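{- ${\tt BBWT}(u_k^R) = (\mathtt{b}\mathtt{a})^k(\prod_{i=1}^k\text{\tt \&}_i)(\prod_{i=1}^k\text{\tt \#}_i)\,\mathtt{a}^k$ and $r_B(u_k^R) = 4k+1$.
   Context: Let $k\ge 1$ and let $\Sigma = \{\mathtt{a},\mathtt{b}\} \cup \bigcup_{i\in[1,k]} \{\text{\tt \#}_i,\text{\tt \&}_i\}$ be ordered as $\text{\tt \#}_1< \text{\tt \&}_1 < \text{\tt \#}_2 < \text{\tt \&}_2 < \dots < \text{\tt \#}_k < \text{\tt \&}_k < \mathtt{a} < \mathtt{b}$. Define $u_k = \prod_{i=1}^k \mathtt{b}\,\mathtt{a}\,\text{\tt \#}_i\,\mathtt{a}\,\text{\tt \&}_i$ and let $u_k^R$ be its reverse. The bijective Burrows–Wheeler transform ${\tt BBWT}(w)$ is obtained by taking all rotations of all factors of the Lyndon factorization of $w$, sorting them in $\omega$-order ($x<_\omega y$ iff $x^\omega$ is lexicographically smaller than $y^\omega$), and concatenating their last characters; $r_B(w)$ is the number of runs in ${\tt BBWT}(w)$. The Lyndon factorization of $u_k^R$ is $(\text{\tt \&}_{k-j}\mathtt{a},\ \text{\tt \#}_{k-j}\mathtt{a}\mathtt{b})_{j=0}^{k-1}$. -}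

module Defs where

open import Data.Nat using (ℕ; zero; suc; _+_; _*_; _<_)
open import Data.Nat.DivMod using (_%_; m%n<n)
open import Data.Fin using (Fin; toℕ; fromℕ<)
open import Data.Fin.Properties renaming (_≟_ to _≟ᶠ_)
open import Data.List using (List; []; _∷_; _++_; reverse; concat; concatMap; map; length; lookup; drop; take; upTo; allFin; last; replicate)
open import Data.List.Relation.Binary.Permutation.Propositional using (_↭_)
open import Data.List.Relation.Unary.All using (All)
open import Data.List.Relation.Unary.Linked using (Linked)
open import Data.Maybe using (Maybe; just; nothing)
open import Data.Product using (Σ; ∃; _×_; _,_)
open import Data.Empty using (⊥)
open import Relation.Nullary using (¬_; Dec; yes; no)
open import Relation.Binary.PropositionalEquality using (_≡_; _≢_; refl; cong)

-- The alphabet Σ = {a,b} ∪ {#_i, &_i | i ∈ [1,k]}.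
-- Index i : Fin k stands for the paper's index i+1.

data Sym (k : ℕ) : Set where
  hash : Fin k → Sym k
  amp  : Fin k → Sym k
  a    : Sym k
  b    : Sym k

rank : ∀ {k} → Sym k → ℕ
rank         (hash i) = 2 * toℕ i
rank         (amp i)  = suc (2 * toℕ i)
rank {k}     a        = 2 * k
rank {k}     b        = suc (2 * k)

_<ₛ_ : ∀ {k} → Sym k → Sym k → Set
x <ₛ y = rank x < rank y

_≟ₛ_ : ∀ {k} (x y : Sym k) → Dec (x ≡ y)
hash i ≟ₛ hash j with i ≟ᶠ j
... | yes refl = yes refl
... | no ne    = no λ { refl → ne refl }
hash i ≟ₛ amp j  = no λ ()
hash i ≟ₛ a      = no λ ()
hash i ≟ₛ b      = no λ ()
amp i  ≟ₛ hash j = no λ ()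
amp i  ≟ₛ amp j with i ≟ᶠ j
... | yes refl = yes refl
... | no ne    = no λ { refl → ne refl }
amp i  ≟ₛ a      = no λ ()
amp i  ≟ₛ b      = no λ ()
a      ≟ₛ hash j = no λ ()
a      ≟ₛ amp j  = no λ ()
a      ≟ₛ a      = yes refl
a      ≟ₛ b      = no λ ()
b      ≟ₛ hash j = no λ ()
b      ≟ₛ amp j  = no λ ()
b      ≟ₛ a      = no λ ()
b      ≟ₛ b      = yes refl

Word : ℕ → Set
Word k = List (Sym k)

data _<ˡ_ {k : ℕ} : Word k → Word k → Set where
  []<∷  : ∀ {y ys} → [] <ˡ (y ∷ ys)
  here  : ∀ {x y xs ys} → x <ₛ y → (x ∷ xs) <ˡ (y ∷ ys)
  there : ∀ {x xs ys} → xs <ˡ ys → (x ∷ xs) <ˡ (x ∷ ys)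

_≤ˡ_ : ∀ {k} → Word k → Word k → Set
x ≤ˡ y = ¬ (y <ˡ x)

data NonEmpty {A : Set} : List A → Set where
  nonEmpty : ∀ {x xs} → NonEmpty (x ∷ xs)

IsLyndon : ∀ {k} → Word k → Set
IsLyndon {k} w = NonEmpty w ×
  ((u v : Word k) → NonEmpty u → NonEmpty v → w ≡ u ++ v → w <ˡ (v ++ u))

IsLyndonFactorization : ∀ {k} → Word k → List (Word k) → Set
IsLyndonFactorization w fs =
  (w ≡ concat fs) × All IsLyndon fs × Linked (λ x y → y ≤ˡ x) fs

-- ω-order: x <ω y iff x^ω is lexicographically smaller than y^ω.

powAt : ∀ {k} → Word k → ℕ → Maybe (Sym k)
powAt []       i = nothing
powAt (c ∷ cs) i = just (lookup (c ∷ cs) (fromℕ< (m%n<n i (length (c ∷ cs)))))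

data MaybeLt {k : ℕ} : Maybe (Sym k) → Maybe (Sym k) → Set where
  lt : ∀ {x y} → x <ₛ y → MaybeLt (just x) (just y)

_<ω_ : ∀ {k} → Word k → Word k → Set
x <ω y = ∃ λ n → ((i : ℕ) → i < n → powAt x i ≡ powAt y i) × MaybeLt (powAt x n) (powAt y n)

rot : ∀ {k} → ℕ → Word k → Word k
rot i x = drop i x ++ take i x

rotations : ∀ {k} → Word k → List (Word k)
rotations x = map (λ i → rot i x) (upTo (length x))

IsBBWT : ∀ {k} → Word k → Word k → Set
IsBBWT {k} w L = Σ (List (Word k)) λ fs → Σ (List (Word k)) λ rs →
  IsLyndonFactorization w fs ×
  (rs ↭ concatMap rotations fs) ×
  Linked (λ x y → ¬ (y <ω x)) rs ×
  (map last rs ≡ map just L)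

runsFrom : ∀ {k} → Sym k → Word k → ℕ
runsFrom x []      = 1
runsFrom x (y ∷ r) with x ≟ₛ y
... | yes _ = runsFrom y r
... | no _  = suc (runsFrom y r)

runs : ∀ {k} → Word k → ℕ
runs []      = 0
runs (x ∷ r) = runsFrom x r

u : (k : ℕ) → Word k
u k = concatMap (λ i → b ∷ a ∷ hash i ∷ a ∷ amp i ∷ []) (allFin k)

uR : (k : ℕ) → Word k
uR k = reverse (u k)

expectedBBWT : (k : ℕ) → Word k
expectedBBWT k =
  concat (replicate k (b ∷ a ∷ [])) ++ map amp (allFin k) ++ map hash (allFin k) ++ replicate k a

-- The Lyndon factors of u_k^R are the words &ᵢa and #ᵢab, each of which begins with its unique
-- smallest letter, and their first letters strictly decrease along u_k^R; a factor that ended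
-- inside such a block would be followed by a larger factor, and one that ran past it would contain
-- a letter below its own first letter, so this is the only Lyndon factorization.  No rotation of a
-- factor is a proper prefix of another, so on them the ω-order is plain lexicographic order, a
-- strict total order: the ω-sorted arrangement of the rotations is unique, namely
-- #₁ab < &₁a < … < #ₖab < &ₖa < a&₁ < … < a&ₖ < ab#₁ < … < ab#ₖ < b#₁a < … < b#ₖa,
-- whose last letters spell (ba)^k &₁…&ₖ #₁…#ₖ a^k.  In that word adjacent letters differ except
-- inside the final a^k, which gives 4k + 1 runs.
module Submission where

open import Defs
open import Data.Empty using (⊥; ⊥-elim)
open import Data.Fin using (Fin; toℕ; zero; fromℕ<) renaming (_<_ to _<ᶠ_)
open import Data.Fin.Properties using (toℕ<n; toℕ-injective; fromℕ<-cong)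
open import Data.List
  using (List; []; _∷_; _++_; _∷ʳ_; length; lookup; drop; head; last; map; concat; concatMap;
         replicate; reverse; allFin)
open import Data.List.Properties
  using (∷-injective; ++-assoc; ++-identityʳ; map-++; map-injective; length-map; length-tabulate;
         reverse-++; unfold-reverse; concatMap-++)
open import Data.List.Relation.Binary.Lex.Strict
  using (Lex-<; base; halt; this; next) renaming (<-strictTotalOrder to Lex-strictTotalOrder)
open import Data.List.Relation.Binary.Permutation.Propositional as ↭
  using (_↭_; ↭-refl; ↭-sym; ↭-trans; ↭⇒↭ₛ′; module PermutationReasoning)
open import Data.List.Relation.Binary.Permutation.Propositional.Properties
  using (++⁺; ++⁺ˡ; shifts; ↭-reverse; All-resp-↭)
open import Data.List.Relation.Binary.Pointwise as Pointwise using (Pointwise; Pointwise-≡⇒≡)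
open import Data.List.Relation.Unary.All using (All; []; _∷_)
import Data.List.Relation.Unary.All as All
import Data.List.Relation.Unary.All.Properties as All
open import Data.List.Relation.Unary.AllPairs using (AllPairs; []; _∷_)
import Data.List.Relation.Unary.AllPairs.Properties as AllPairs
open import Data.List.Relation.Unary.Linked as Linked using (Linked; []; [-]; _∷_)
import Data.List.Relation.Unary.Linked.Properties as Linked
open import Data.List.Relation.Unary.Sorted.TotalOrder.Properties using (↗↭↗⇒≋)
open import Data.Maybe using (Maybe; just)
open import Data.Maybe.Properties using (just-injective)
open import Data.Maybe.Relation.Binary.Connected using (Connected; just; nothing-just)
open import Data.Nat using (ℕ; zero; suc; _+_; _*_; _<_; _≤_; s≤s; z≤n; s<s⁻¹)
open import Data.Nat.DivMod using (m<n⇒m%n≡m)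
open import Data.Nat.Properties
open import Data.Nat.Solver using (module +-*-Solver)
open import Data.Product using (∃-syntax; ∃₂; _×_; _,_; proj₁; proj₂)
open import Data.Sum using (_⊎_; inj₁; inj₂)
open import Function using (_∘_; id; flip)
open import Level using (0ℓ)
open import Relation.Binary
  using (IsStrictTotalOrder; StrictTotalOrder; DecTotalOrder; Trichotomous; tri<; tri≈; tri>)
import Relation.Binary.Properties.StrictTotalOrder as StrictTotalOrderProperties
open import Relation.Binary.PropositionalEquality
open import Relation.Nullary using (¬_; yes; no)

module _ {A : Set} where

  ++-split : (xs ys us vs : List A) → xs ++ ys ≡ us ++ vs →
    (xs ≡ us × ys ≡ vs)
    ⊎ (∃₂ λ d ws → us ≡ xs ++ d ∷ ws × ys ≡ d ∷ ws ++ vs)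
    ⊎ (∃₂ λ d ws → xs ≡ us ++ d ∷ ws × vs ≡ d ∷ ws ++ ys)
  ++-split []       ys []       vs eq = inj₁ (refl , eq)
  ++-split []       ys (u ∷ us) vs eq = inj₂ (inj₁ (u , us , refl , eq))
  ++-split (x ∷ xs) ys []       vs eq = inj₂ (inj₂ (x , xs , refl , sym eq))
  ++-split (x ∷ xs) ys (u ∷ us) vs eq with ∷-injective eq
  ... | refl , eq′ with ++-split xs ys us vs eq′
  ... | inj₁ (refl , ys≡vs)               = inj₁ (refl , ys≡vs)
  ... | inj₂ (inj₁ (d , ws , refl , ys≡)) = inj₂ (inj₁ (d , ws , refl , ys≡))
  ... | inj₂ (inj₂ (d , ws , refl , vs≡)) = inj₂ (inj₂ (d , ws , refl , vs≡))

  Linked-map-All : {P : A → Set} {R R′ : A → A → Set} {xs : List A} →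
    (∀ {x y} → P x → P y → R x y → R′ x y) → All P xs → Linked R xs → Linked R′ xs
  Linked-map-All f _                []      = []
  Linked-map-All f _                [-]     = [-]
  Linked-map-All f (px ∷ py ∷ pxs) (r ∷ l) = f px py r ∷ Linked-map-All f (py ∷ pxs) l

  Linked-++⁺ : {P Q : A → Set} {R : A → A → Set} {xs ys : List A} →
    (∀ {x y} → P x → Q y → R x y) → All P xs → All Q ys →
    Linked R xs → Linked R ys → Linked R (xs ++ ys)
  Linked-++⁺ sep []        _        []        Rys = Rys
  Linked-++⁺ sep (px ∷ []) (qy ∷ _) [-]       Rys = sep px qy ∷ Rys
  Linked-++⁺ sep (_ ∷ [])  []       [-]       _   = [-]
  Linked-++⁺ sep (_ ∷ pxs) qys      (r ∷ Rxs) Rys = r ∷ Linked-++⁺ sep pxs qys Rxs Rys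

  Connected-last : {R : A → A → Set} {y : A} {xs : List A} →
    All (λ x → R x y) xs → Connected R (last xs) (just y)
  Connected-last []               = nothing-just
  Connected-last (r ∷ [])         = just r
  Connected-last (_ ∷ rs@(_ ∷ _)) = Connected-last rs

  AllPairs-reverse⁺ : {R : A → A → Set} {xs : List A} → AllPairs R xs → AllPairs (flip R) (reverse xs)
  AllPairs-reverse⁺                 []         = []
  AllPairs-reverse⁺ {R} {x ∷ xs} (Rx ∷ Rxs) = subst (AllPairs (flip R)) (sym (unfold-reverse x xs))
    (AllPairs.++⁺ (AllPairs-reverse⁺ Rxs) ([] ∷ [])
      (All.map (_∷ []) (All-resp-↭ (↭-sym (↭-reverse xs)) Rx)))

module _ {A B : Set} where

  reverse-concatMap : (f : A → List B) (xs : List A) →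
    reverse (concatMap f xs) ≡ concatMap (reverse ∘ f) (reverse xs)
  reverse-concatMap f []       = refl
  reverse-concatMap f (x ∷ xs) = begin
    reverse (f x ++ concatMap f xs)
      ≡⟨ reverse-++ (f x) (concatMap f xs) ⟩
    reverse (concatMap f xs) ++ reverse (f x)
      ≡⟨ cong₂ _++_ (reverse-concatMap f xs) (sym (++-identityʳ _)) ⟩
    concatMap (reverse ∘ f) (reverse xs) ++ concatMap (reverse ∘ f) (x ∷ [])
      ≡⟨ concatMap-++ (reverse ∘ f) (reverse xs) (x ∷ []) ⟨
    concatMap (reverse ∘ f) (reverse xs ∷ʳ x)
      ≡⟨ cong (concatMap (reverse ∘ f)) (unfold-reverse x xs) ⟨
    concatMap (reverse ∘ f) (reverse (x ∷ xs)) ∎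
    where open ≡-Reasoning

  concatMap⁺ : (f : A → List B) {xs ys : List A} → xs ↭ ys → concatMap f xs ↭ concatMap f ys
  concatMap⁺ f ↭.refl         = ↭-refl
  concatMap⁺ f (↭.prep x p)   = ++⁺ˡ (f x) (concatMap⁺ f p)
  concatMap⁺ f (↭.swap x y p) = ↭-trans (++⁺ˡ (f x) (++⁺ˡ (f y) (concatMap⁺ f p))) (shifts (f x) (f y))
  concatMap⁺ f (↭.trans p q)  = ↭-trans (concatMap⁺ f p) (concatMap⁺ f q)

  concatMap-++-↭ : {f g h : A → List B} → (∀ x → f x ↭ g x ++ h x) →
    (xs : List A) → concatMap f xs ↭ concatMap g xs ++ concatMap h xs
  concatMap-++-↭ split []                   = ↭-refl
  concatMap-++-↭ {f} {g} {h} split (x ∷ xs) = begin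
    f x ++ concatMap f xs                              ↭⟨ ++⁺ (split x) (concatMap-++-↭ split xs) ⟩
    (g x ++ h x) ++ concatMap g xs ++ concatMap h xs   ≡⟨ ++-assoc (g x) (h x) _ ⟩
    g x ++ h x ++ concatMap g xs ++ concatMap h xs     ↭⟨ ++⁺ˡ (g x) (shifts (h x) (concatMap g xs)) ⟩
    g x ++ concatMap g xs ++ h x ++ concatMap h xs     ≡⟨ ++-assoc (g x) (concatMap g xs) _ ⟨
    (g x ++ concatMap g xs) ++ h x ++ concatMap h xs   ∎
    where open PermutationReasoning

  concatMap-[-] : (f : A → B) (xs : List A) → concatMap (λ x → f x ∷ []) xs ≡ map f xs
  concatMap-[-] f []       = refl
  concatMap-[-] f (x ∷ xs) = cong (f x ∷_) (concatMap-[-] f xs)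

  map-++₄ : (f : A → B) (ws xs ys zs : List A) →
    map f (ws ++ xs ++ ys ++ zs) ≡ map f ws ++ map f xs ++ map f ys ++ map f zs
  map-++₄ f ws xs ys zs = trans (map-++ f ws _)
    (cong (map f ws ++_) (trans (map-++ f xs _) (cong (map f xs ++_) (map-++ f ys zs))))

  All-map-universal : {P : B → Set} {f : A → B} → (∀ x → P (f x)) → (xs : List A) → All P (map f xs)
  All-map-universal Pf xs = All.map⁺ (All.universal Pf xs)

allFin-sorted : (n : ℕ) → Linked _<ᶠ_ (allFin n)
allFin-sorted n = Linked.AllPairs⇒Linked (AllPairs.tabulate⁺-< id)

Linked-map-allFin : {A : Set} {R : A → A → Set} {n : ℕ} (f : Fin n → A) →
  (∀ {i j} → i <ᶠ j → R (f i) (f j)) → Linked R (map f (allFin n))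
Linked-map-allFin {n = n} f mono = Linked.map⁺ (Linked.map mono (allFin-sorted n))

m<n⇒1+2m<2n : ∀ {m n} → m < n → suc (2 * m) < 2 * n
m<n⇒1+2m<2n {m} {n} m<n = subst (_≤ 2 * n) (*-suc 2 m) (*-monoʳ-≤ 2 m<n)

a<b : (k : ℕ) → a <ₛ b {k}
a<b k = n<1+n (2 * k)

module _ {k : ℕ} where

  hash<amp : (i : Fin k) → hash i <ₛ amp i
  hash<amp i = n<1+n (2 * toℕ i)

  amp<hash : {i j : Fin k} → i <ᶠ j → amp i <ₛ hash j
  amp<hash = m<n⇒1+2m<2n

  hash<hash : {i j : Fin k} → i <ᶠ j → hash i <ₛ hash j
  hash<hash = *-monoʳ-< 2

  amp<amp : {i j : Fin k} → i <ᶠ j → amp i <ₛ amp j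
  amp<amp = s≤s ∘ hash<hash

  hash<a : (i : Fin k) → hash i <ₛ a
  hash<a i = *-monoʳ-< 2 (toℕ<n i)

  amp<a : (i : Fin k) → amp i <ₛ a
  amp<a i = m<n⇒1+2m<2n (toℕ<n i)

  hash<b : (i : Fin k) → hash i <ₛ b
  hash<b i = <-trans (hash<a i) (a<b k)

  rank-injective : (x y : Sym k) → rank x ≡ rank y → x ≡ y
  rank-injective (hash i) (hash j) eq = cong hash (toℕ-injective (*-cancelˡ-≡ _ _ 2 eq))
  rank-injective (amp i)  (amp j)  eq = cong amp (toℕ-injective (*-cancelˡ-≡ _ _ 2 (suc-injective eq)))
  rank-injective a        a        eq = refl
  rank-injective b        b        eq = refl
  rank-injective (hash i) (amp j)  eq = ⊥-elim (even≢odd (toℕ i) (toℕ j) eq)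
  rank-injective (hash i) b        eq = ⊥-elim (even≢odd (toℕ i) k eq)
  rank-injective (amp i)  (hash j) eq = ⊥-elim (even≢odd (toℕ j) (toℕ i) (sym eq))
  rank-injective (amp i)  a        eq = ⊥-elim (even≢odd k (toℕ i) (sym eq))
  rank-injective a        (amp j)  eq = ⊥-elim (even≢odd k (toℕ j) eq)
  rank-injective a        b        eq = ⊥-elim (even≢odd k k eq)
  rank-injective b        (hash j) eq = ⊥-elim (even≢odd (toℕ j) k (sym eq))
  rank-injective b        a        eq = ⊥-elim (even≢odd k k (sym eq))
  rank-injective (hash i) a        eq = ⊥-elim (<-irrefl (*-cancelˡ-≡ (toℕ i) k 2 eq) (toℕ<n i))
  rank-injective a        (hash j) eq = ⊥-elim (<-irrefl (*-cancelˡ-≡ (toℕ j) k 2 (sym eq)) (toℕ<n j))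
  rank-injective (amp i)  b        eq = ⊥-elim (<-irrefl (*-cancelˡ-≡ (toℕ i) k 2 (suc-injective eq)) (toℕ<n i))
  rank-injective b        (amp j)  eq =
    ⊥-elim (<-irrefl (*-cancelˡ-≡ (toℕ j) k 2 (suc-injective (sym eq))) (toℕ<n j))

  <ₛ-compare : Trichotomous _≡_ (_<ₛ_ {k})
  <ₛ-compare x y with <-cmp (rank x) (rank y)
  ... | tri< x<y x≢y x≯y = tri< x<y (x≢y ∘ cong rank) x≯y
  ... | tri≈ x≮y x≡y x≯y = tri≈ x≮y (rank-injective x y x≡y) x≯y
  ... | tri> x≮y x≢y x>y = tri> x≮y (x≢y ∘ cong rank) x>y

  <ₛ-isStrictTotalOrder : IsStrictTotalOrder _≡_ (_<ₛ_ {k})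
  <ₛ-isStrictTotalOrder = record
    { isStrictPartialOrder = record
      { isEquivalence = isEquivalence
      ; irrefl        = λ { refl → <-irrefl refl }
      ; trans         = <-trans
      ; <-resp-≈      = resp₂ _<ₛ_
      }
    ; compare = <ₛ-compare
    }

-- The library's lexicographic order, used instead of Defs' _<ˡ_ for its strict-total-order structure.
_<ʷ_ : ∀ {k} → Word k → Word k → Set
_<ʷ_ = Lex-< _≡_ _<ₛ_

<ʷ-strictTotalOrder : ℕ → StrictTotalOrder 0ℓ 0ℓ 0ℓ
<ʷ-strictTotalOrder k = Lex-strictTotalOrder (record { isStrictTotalOrder = <ₛ-isStrictTotalOrder {k} })

-- ω-order versus lexicographic order

module _ {k : ℕ} where

  MaybeLt-irrefl : {p : Maybe (Sym k)} → ¬ MaybeLt p p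
  MaybeLt-irrefl (lt r) = <-irrefl refl r

  MaybeLt-asym : {p q : Maybe (Sym k)} → MaybeLt p q → ¬ MaybeLt q p
  MaybeLt-asym (lt r) (lt r′) = <-asym r r′

  <ω-asym : {x y : Word k} → x <ω y → ¬ y <ω x
  <ω-asym {x} {y} (m , x≈y , x<y) (n , y≈x , y<x) with <-cmp m n
  ... | tri< m<n _ _  = MaybeLt-irrefl (subst (MaybeLt (powAt x m)) (y≈x m m<n) x<y)
  ... | tri≈ _ refl _ = MaybeLt-asym x<y y<x
  ... | tri> _ _ n<m  = MaybeLt-irrefl (subst (MaybeLt (powAt y n)) (x≈y n n<m) y<x)

  lookup-fromℕ< : (xs : Word k) {i : ℕ} (i<n : i < length xs) →
    just (lookup xs (fromℕ< i<n)) ≡ head (drop i xs)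
  lookup-fromℕ< (x ∷ xs) {zero}  _   = refl
  lookup-fromℕ< (x ∷ xs) {suc i} i<n = lookup-fromℕ< xs (s<s⁻¹ i<n)

  powAt-<length : {x : Word k} {i : ℕ} → i < length x → powAt x i ≡ head (drop i x)
  powAt-<length {c ∷ cs} {i} i<n = trans
    (cong (just ∘ lookup (c ∷ cs)) (fromℕ<-cong _ _ (m<n⇒m%n≡m i<n) _ i<n))
    (lookup-fromℕ< (c ∷ cs) i<n)

  DiffersFirstAt : ℕ → Word k → Word k → Set
  DiffersFirstAt n x y =
    n < length x × n < length y ×
    (∀ i → i < n → head (drop i x) ≡ head (drop i y)) ×
    MaybeLt (head (drop n x)) (head (drop n y))

  differsFirstAt-∷ : {c : Sym k} {xs ys : Word k} {n : ℕ} →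
    DiffersFirstAt n xs ys → DiffersFirstAt (suc n) (c ∷ xs) (c ∷ ys)
  differsFirstAt-∷ {c} {xs} {ys} {n} (n<∣xs∣ , n<∣ys∣ , agree , differ) =
    s≤s n<∣xs∣ , s≤s n<∣ys∣ , agree′ , differ
    where
      agree′ : ∀ i → i < suc n → head (drop i (c ∷ xs)) ≡ head (drop i (c ∷ ys))
      agree′ zero    _   = refl
      agree′ (suc i) i<n = agree i (s<s⁻¹ i<n)

  <ʷ⇒differsFirstAt : {x y : Word k} → x <ʷ y → (∀ {c t} → y ≢ x ++ c ∷ t) →
    ∃[ n ] DiffersFirstAt n x y
  <ʷ⇒differsFirstAt (base ())         _
  <ʷ⇒differsFirstAt halt              notPrefix = ⊥-elim (notPrefix refl)
  <ʷ⇒differsFirstAt (this c<d)        _         = 0 , s≤s z≤n , s≤s z≤n , (λ _ ()) , lt c<d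
  <ʷ⇒differsFirstAt (next refl xs<ys) notPrefix with <ʷ⇒differsFirstAt xs<ys (notPrefix ∘ cong (_ ∷_))
  ... | n , differs = suc n , differsFirstAt-∷ differs

  <ʷ⇒<ω : {x y : Word k} → x <ʷ y → (∀ {c t} → y ≢ x ++ c ∷ t) → x <ω y
  <ʷ⇒<ω {x} {y} x<y notPrefix with <ʷ⇒differsFirstAt x<y notPrefix
  ... | n , n<∣x∣ , n<∣y∣ , agree , differ =
    n , agreeω , subst₂ MaybeLt (sym (powAt-<length n<∣x∣)) (sym (powAt-<length n<∣y∣)) differ
    where
      agreeω : ∀ i → i < n → powAt x i ≡ powAt y i
      agreeω i i<n = trans (powAt-<length (<-trans i<n n<∣x∣))
        (trans (agree i i<n) (sym (powAt-<length (<-trans i<n n<∣y∣))))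

PrefixFree : ∀ {k} → (Word k → Set) → Set
PrefixFree S = ∀ {x c t} → S x → S (x ++ c ∷ t) → ⊥

module _ {k : ℕ} {S : Word k → Set} (prefixFree : PrefixFree S) where

  <ʷ⇒<ω-prefixFree : {x y : Word k} → S x → S y → x <ʷ y → x <ω y
  <ʷ⇒<ω-prefixFree sx sy x<y = <ʷ⇒<ω x<y (λ y≡x++ct → prefixFree sx (subst S y≡x++ct sy))

  lexSorted⇒ωSorted : {rs : List (Word k)} → All S rs → Linked _<ʷ_ rs → Linked (λ x y → ¬ y <ω x) rs
  lexSorted⇒ωSorted = Linked-map-All (λ sx sy x<y → <ω-asym (<ʷ⇒<ω-prefixFree sx sy x<y))

  ωSorted-unique : {rs rs′ : List (Word k)} → All S rs → rs ↭ rs′ →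
    Linked _<ʷ_ rs′ → Linked (λ x y → ¬ y <ω x) rs → rs ≡ rs′
  ωSorted-unique Srs rs↭rs′ lexSorted ωSorted = Pointwise-≡⇒≡ (Pointwise.map Pointwise-≡⇒≡
    (↗↭↗⇒≋ totalOrder (Linked-map-All ≮ω⇒≤ Srs ωSorted) (Linked.map inj₁ lexSorted)
      (↭⇒↭ₛ′ ≋-isEquivalence rs↭rs′)))
    where
      open StrictTotalOrder (<ʷ-strictTotalOrder k) using (compare)
      open DecTotalOrder (StrictTotalOrderProperties.decTotalOrder (<ʷ-strictTotalOrder k))
        using (totalOrder) renaming (isEquivalence to ≋-isEquivalence)

      ≮ω⇒≤ : {x y : Word k} → S x → S y → ¬ y <ω x → x <ʷ y ⊎ Pointwise _≡_ x y
      ≮ω⇒≤ {x} {y} sx sy y≮x with compare x y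
      ... | tri< x<y _ _ = inj₁ x<y
      ... | tri≈ _ x≈y _ = inj₂ x≈y
      ... | tri> _ _ y<x = ⊥-elim (y≮x (<ʷ⇒<ω-prefixFree sy sx y<x))

-- Factorizations into blocks headed by their smallest letter

Block : ℕ → Set
Block k = Sym k × Word k

block : ∀ {k} → Block k → Word k
block (s , t) = s ∷ t

HeadMinimal : ∀ {k} → Block k → Set
HeadMinimal (s , t) = All (s <ₛ_) t

HeadsDecreasing : ∀ {k} → List (Block k) → Set
HeadsDecreasing = Linked (λ p q → proj₁ q <ₛ proj₁ p)

module _ {k : ℕ} where

  head>⇒¬<ˡ : {c d : Sym k} {xs ys : Word k} → d <ₛ c → ¬ (c ∷ xs) <ˡ (d ∷ ys)
  head>⇒¬<ˡ d<c (here c<d) = <-asym c<d d<c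
  head>⇒¬<ˡ d<c (there _)  = <-irrefl refl d<c

  headMinimal⇒lyndon : {s : Sym k} {t : Word k} → All (s <ₛ_) t → IsLyndon (s ∷ t)
  headMinimal⇒lyndon {s} {t} s<t = nonEmpty , below-rotations
    where
      below-rotations : ∀ u v → NonEmpty u → NonEmpty v → s ∷ t ≡ u ++ v → (s ∷ t) <ˡ (v ++ u)
      below-rotations (_ ∷ u) (_ ∷ v) _ _ eq =
        here (All.head (All.++⁻ʳ u (subst (All (s <ₛ_)) (proj₂ (∷-injective eq)) s<t)))

  lyndon-¬letter<head : {s d : Sym k} {u v : Word k} → IsLyndon (s ∷ u ++ d ∷ v) → ¬ d <ₛ s
  lyndon-¬letter<head {s} {d} {u} {v} (_ , below-rotations) d<s =
    head>⇒¬<ˡ d<s (below-rotations (s ∷ u) (d ∷ v) nonEmpty nonEmpty refl)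

  blocks-isLyndonFactorization : {bs : List (Block k)} → All HeadMinimal bs → HeadsDecreasing bs →
    IsLyndonFactorization (concatMap block bs) (map block bs)
  blocks-isLyndonFactorization minimal decreasing =
      refl
    , All.map⁺ (All.map headMinimal⇒lyndon minimal)
    , Linked.map⁺ (Linked.map (λ { {_ , _} {_ , _} → head>⇒¬<ˡ }) decreasing)

  headsDecreasing-next<head : {s d : Sym k} {t w : Word k} (bs : List (Block k)) →
    HeadsDecreasing ((s , t) ∷ bs) → concatMap block bs ≡ d ∷ w → d <ₛ s
  headsDecreasing-next<head []      _          ()
  headsDecreasing-next<head (_ ∷ _) (s′<s ∷ _) eq with ∷-injective eq
  ... | refl , _ = s′<s

  nonIncreasing-¬head<next : {s d : Sym k} {x w : Word k} (fs : List (Word k)) → All IsLyndon fs →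
    concat fs ≡ d ∷ w → Linked (λ x y → y ≤ˡ x) ((s ∷ x) ∷ fs) → ¬ s <ₛ d
  nonIncreasing-¬head<next []            _              () _
  nonIncreasing-¬head<next ([] ∷ _)      ((() , _) ∷ _) _  _
  nonIncreasing-¬head<next ((_ ∷ _) ∷ _) _              eq (¬x<y ∷ _) s<d with ∷-injective eq
  ... | refl , _ = ¬x<y (here s<d)

  blocks-lyndonFactorization-unique : (bs : List (Block k)) (fs : List (Word k)) →
    All HeadMinimal bs → HeadsDecreasing bs →
    IsLyndonFactorization (concatMap block bs) fs → fs ≡ map block bs
  blocks-lyndonFactorization-unique []      []            _ _ _                      = refl
  blocks-lyndonFactorization-unique _       ([] ∷ _)      _ _ (_ , (() , _) ∷ _ , _)
  blocks-lyndonFactorization-unique []      ((_ ∷ _) ∷ _) _ _ (() , _)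
  blocks-lyndonFactorization-unique (_ ∷ _) []            _ _ (() , _)
  blocks-lyndonFactorization-unique ((s , t) ∷ bs) ((_ ∷ f) ∷ fs) (s<t ∷ minimal) decreasing
    (eq , lyndon ∷ lyndons , nonIncreasing) with ∷-injective eq
  ... | refl , eq′ with ++-split t (concatMap block bs) f (concat fs) eq′
  ... | inj₁ (refl , eq″) = cong ((s ∷ t) ∷_) (blocks-lyndonFactorization-unique bs fs minimal
          (Linked.tail decreasing) (eq″ , lyndons , Linked.tail nonIncreasing))
  ... | inj₂ (inj₁ (_ , _ , refl , rest≡)) =
          ⊥-elim (lyndon-¬letter<head lyndon (headsDecreasing-next<head bs decreasing rest≡))
  ... | inj₂ (inj₂ (_ , _ , refl , fs≡)) =
          ⊥-elim (nonIncreasing-¬head<next fs lyndons fs≡ nonIncreasing (All.head (All.++⁻ʳ f s<t)))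

module _ {k : ℕ} where

  runsFrom-++ : (x : Sym k) (xs ys : Word k) → Connected _≢_ (last (x ∷ xs)) (head ys) →
    runsFrom x (xs ++ ys) ≡ runsFrom x xs + runs ys
  runsFrom-++ x []       []       _          = refl
  runsFrom-++ x []       (y ∷ ys) (just x≢y) with x ≟ₛ y
  ... | yes x≡y = ⊥-elim (x≢y x≡y)
  ... | no _    = refl
  runsFrom-++ x (z ∷ zs) ys       c          with x ≟ₛ z
  ... | yes _ = runsFrom-++ z zs ys c
  ... | no _  = cong suc (runsFrom-++ z zs ys c)

  runs-++ : (xs ys : Word k) → Connected _≢_ (last xs) (head ys) → runs (xs ++ ys) ≡ runs xs + runs ys
  runs-++ []       ys _ = refl
  runs-++ (x ∷ xs) ys c = runsFrom-++ x xs ys c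

  runsFrom-distinct : {x : Sym k} {xs : Word k} → Linked _≢_ (x ∷ xs) → runsFrom x xs ≡ suc (length xs)
  runsFrom-distinct {xs = []}          _           = refl
  runsFrom-distinct {x} {xs = y ∷ ys} (x≢y ∷ ≢ys) with x ≟ₛ y
  ... | yes x≡y = ⊥-elim (x≢y x≡y)
  ... | no _    = cong suc (runsFrom-distinct ≢ys)

  runs-distinct : {xs : Word k} → Linked _≢_ xs → runs xs ≡ length xs
  runs-distinct {[]}    _ = refl
  runs-distinct {_ ∷ _} ≢ = runsFrom-distinct ≢

  runs-replicate : (n : ℕ) (x : Sym k) → runs (replicate (suc n) x) ≡ 1
  runs-replicate zero    x = refl
  runs-replicate (suc n) x with x ≟ₛ x
  ... | yes _  = runs-replicate n x
  ... | no x≢x = ⊥-elim (x≢x refl)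

data FactorRotation {k : ℕ} : Word k → Set where
  &a  : (i : Fin k) → FactorRotation (amp i ∷ a ∷ [])
  a&  : (i : Fin k) → FactorRotation (a ∷ amp i ∷ [])
  #ab : (i : Fin k) → FactorRotation (hash i ∷ a ∷ b ∷ [])
  ab# : (i : Fin k) → FactorRotation (a ∷ b ∷ hash i ∷ [])
  b#a : (i : Fin k) → FactorRotation (b ∷ hash i ∷ a ∷ [])

factorRotation-prefixFree : ∀ {k} → PrefixFree (FactorRotation {k})
factorRotation-prefixFree (&a _)  ()
factorRotation-prefixFree (a& _)  ()
factorRotation-prefixFree (#ab _) ()
factorRotation-prefixFree (ab# _) ()
factorRotation-prefixFree (b#a _) ()

module _ (k : ℕ) where

  blockPair : Fin k → List (Block k)
  blockPair i = (amp i , a ∷ []) ∷ (hash i , a ∷ b ∷ []) ∷ []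

  factorBlocks : List (Block k)
  factorBlocks = concatMap blockPair (reverse (allFin k))

  factors : List (Word k)
  factors = map block factorBlocks

  uR≡factorBlocks : uR k ≡ concatMap block factorBlocks
  uR≡factorBlocks = trans (reverse-concatMap _ (allFin k)) (sym (blocks≡ (reverse (allFin k))))
    where
      blocks≡ : ∀ is → concatMap block (concatMap blockPair is) ≡
                       concatMap (λ i → amp i ∷ a ∷ hash i ∷ a ∷ b ∷ []) is
      blocks≡ []       = refl
      blocks≡ (i ∷ is) = cong (λ w → amp i ∷ a ∷ hash i ∷ a ∷ b ∷ w) (blocks≡ is)

  factorBlocks-headMinimal : All HeadMinimal factorBlocks
  factorBlocks-headMinimal = All.concat⁺ (All-map-universal blockPair-headMinimal (reverse (allFin k)))
    where
      blockPair-headMinimal : (i : Fin k) → All HeadMinimal (blockPair i)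
      blockPair-headMinimal i = (amp<a i ∷ []) ∷ (hash<a i ∷ hash<b i ∷ []) ∷ []

  factorBlocks-headsDecreasing : HeadsDecreasing factorBlocks
  factorBlocks-headsDecreasing =
    pairs-decreasing (Linked.AllPairs⇒Linked (AllPairs-reverse⁺ (AllPairs.tabulate⁺-< id)))
    where
      pairs-decreasing : ∀ {is} → Linked (flip _<ᶠ_) is → HeadsDecreasing (concatMap blockPair is)
      pairs-decreasing               []          = []
      pairs-decreasing {i ∷ _}       [-]         = hash<amp i ∷ [-]
      pairs-decreasing {i ∷ j ∷ _} (j<i ∷ j<s) =
        hash<amp i ∷ amp<hash {i = j} {j = i} j<i ∷ pairs-decreasing j<s

  uR-isLyndonFactorization : IsLyndonFactorization (uR k) factors
  uR-isLyndonFactorization = subst (λ w → IsLyndonFactorization w factors) (sym uR≡factorBlocks)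
    (blocks-isLyndonFactorization factorBlocks-headMinimal factorBlocks-headsDecreasing)

  uR-lyndonFactorization-unique : {fs : List (Word k)} → IsLyndonFactorization (uR k) fs → fs ≡ factors
  uR-lyndonFactorization-unique (uR≡fs , lyndon) =
    blocks-lyndonFactorization-unique factorBlocks _ factorBlocks-headMinimal factorBlocks-headsDecreasing
      (trans (sym uR≡factorBlocks) uR≡fs , lyndon)

  belowA : Fin k → List (Word k)
  belowA i = (hash i ∷ a ∷ b ∷ []) ∷ (amp i ∷ a ∷ []) ∷ []

  sortedRotations : List (Word k)
  sortedRotations = concatMap belowA (allFin k)
    ++ map (λ i → a ∷ amp i ∷ []) (allFin k)
    ++ map (λ i → a ∷ b ∷ hash i ∷ []) (allFin k)
    ++ map (λ i → b ∷ hash i ∷ a ∷ []) (allFin k)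

  sortedRotations-↭ : sortedRotations ↭ concatMap rotations factors
  sortedRotations-↭ = ↭-sym (begin
    concatMap rotations factors
      ≡⟨ rotations≡ (reverse (allFin k)) ⟩
    concatMap rotationsOf (reverse (allFin k))
      ↭⟨ concatMap⁺ rotationsOf (↭-reverse (allFin k)) ⟩
    concatMap rotationsOf (allFin k)
      ↭⟨ concatMap-++-↭ (λ _ → ↭-trans (↭.prep _ (↭.swap _ _ ↭-refl)) (↭.swap _ _ ↭-refl))
                        (allFin k) ⟩
    concatMap belowA (allFin k) ++ concatMap aboveA (allFin k)
      ↭⟨ ++⁺ˡ _ (↭-trans (concatMap-++-↭ {g = [a&]} (λ _ → ↭-refl) (allFin k))
                         (++⁺ˡ _ (concatMap-++-↭ {g = [ab#]} (λ _ → ↭-refl) (allFin k)))) ⟩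
    concatMap belowA (allFin k) ++
      concatMap [a&] (allFin k) ++ concatMap [ab#] (allFin k) ++ concatMap [b#a] (allFin k)
      ≡⟨ cong (concatMap belowA (allFin k) ++_) (cong₂ _++_ (concatMap-[-] _ (allFin k))
           (cong₂ _++_ (concatMap-[-] _ (allFin k)) (concatMap-[-] _ (allFin k)))) ⟩
    sortedRotations ∎)
    where
      open PermutationReasoning
      rotationsOf : Fin k → List (Word k)
      rotationsOf i = concatMap rotations (map block (blockPair i))
      rotations≡ : ∀ is → concatMap rotations (map block (concatMap blockPair is)) ≡ concatMap rotationsOf is
      rotations≡ []       = refl
      rotations≡ (i ∷ is) = cong (rotationsOf i ++_) (rotations≡ is)
      [a&] [ab#] [b#a] aboveA : Fin k → List (Word k)
      [a&] i   = (a ∷ amp i ∷ []) ∷ []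
      [ab#] i  = (a ∷ b ∷ hash i ∷ []) ∷ []
      [b#a] i  = (b ∷ hash i ∷ a ∷ []) ∷ []
      aboveA i = [a&] i ++ [ab#] i ++ [b#a] i

  sortedRotations-factorRotation : All FactorRotation sortedRotations
  sortedRotations-factorRotation =
    All.++⁺ (All.concat⁺ (All-map-universal (λ i → #ab i ∷ &a i ∷ []) (allFin k)))
      (All.++⁺ (All-map-universal a& (allFin k))
        (All.++⁺ (All-map-universal ab# (allFin k)) (All-map-universal b#a (allFin k))))

  sortedRotations-sorted : Linked _<ʷ_ sortedRotations
  sortedRotations-sorted =
    Linked-++⁺ {P = _<ʷ (a ∷ [])} {Q = (a ∷ []) <ʷ_} <ʷ-trans
      (All.concat⁺ (All-map-universal (λ i → this (hash<a i) ∷ this (amp<a i) ∷ []) (allFin k)))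
      (All.++⁺ (every (λ _ → next refl halt))
        (All.++⁺ (every (λ _ → next refl halt)) (every (λ _ → this (a<b k)))))
      (belowA-sorted (allFin-sorted k))
    (Linked-++⁺ {P = _<ʷ (a ∷ b ∷ [])} {Q = (a ∷ b ∷ []) <ʷ_} <ʷ-trans
      (every (λ i → next refl (this (<-trans (amp<a i) (a<b k)))))
      (All.++⁺ (every (λ _ → next refl (next refl halt))) (every (λ _ → this (a<b k))))
      (Linked-map-allFin _ (next refl ∘ this ∘ amp<amp))
    (Linked-++⁺ {P = _<ʷ (b ∷ [])} {Q = (b ∷ []) <ʷ_} <ʷ-trans
      (every (λ _ → this (a<b k)))
      (every (λ _ → next refl halt))
      (Linked-map-allFin _ (next refl ∘ next refl ∘ this ∘ hash<hash))
      (Linked-map-allFin _ (next refl ∘ this ∘ hash<hash))))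
    where
      open StrictTotalOrder (<ʷ-strictTotalOrder k) using () renaming (trans to <ʷ-trans)
      every : {P : Word k → Set} {f : Fin k → Word k} → (∀ i → P (f i)) → All P (map f (allFin k))
      every Pf = All-map-universal Pf (allFin k)
      belowA-sorted : ∀ {is} → Linked _<ᶠ_ is → Linked _<ʷ_ (concatMap belowA is)
      belowA-sorted               []          = []
      belowA-sorted {i ∷ _}       [-]         = this (hash<amp i) ∷ [-]
      belowA-sorted {i ∷ j ∷ _} (i<j ∷ i<s) =
        this (hash<amp i) ∷ this (amp<hash {i = i} {j = j} i<j) ∷ belowA-sorted i<s

  sortedRotations-lasts : map last sortedRotations ≡ map just (expectedBBWT k)
  sortedRotations-lasts = begin
    map last sortedRotations
      ≡⟨ map-++₄ last (concatMap belowA (allFin k)) a&s ab#s b#as ⟩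
    map last (concatMap belowA (allFin k)) ++ map last a&s ++ map last ab#s ++ map last b#as
      ≡⟨ cong₂ _++_ (belowA-lasts (allFin k)) (cong₂ _++_ (lasts-map (λ _ → refl) (allFin k))
           (cong₂ _++_ (lasts-map (λ _ → refl) (allFin k)) (b#a-lasts (allFin k)))) ⟩
    bbwt (length (allFin k))
      ≡⟨ cong bbwt (length-tabulate {n = k} id) ⟩
    bbwt k
      ≡⟨ map-++₄ just (concat (replicate k (b ∷ a ∷ []))) (map amp (allFin k))
                 (map hash (allFin k)) (replicate k a) ⟨
    map just (expectedBBWT k) ∎
    where
      open ≡-Reasoning
      a&s ab#s b#as : List (Word k)
      a&s  = map (λ i → a ∷ amp i ∷ []) (allFin k)
      ab#s = map (λ i → a ∷ b ∷ hash i ∷ []) (allFin k)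
      b#as = map (λ i → b ∷ hash i ∷ a ∷ []) (allFin k)
      bbwt : ℕ → List (Maybe (Sym k))
      bbwt n = map just (concat (replicate n (b ∷ a ∷ []))) ++ map just (map amp (allFin k))
        ++ map just (map hash (allFin k)) ++ map just (replicate n a)
      belowA-lasts : ∀ is →
        map last (concatMap belowA is) ≡ map just (concat (replicate (length is) (b ∷ a ∷ [])))
      belowA-lasts []       = refl
      belowA-lasts (_ ∷ is) = cong (λ w → just b ∷ just a ∷ w) (belowA-lasts is)
      lasts-map : {f : Fin k → Word k} {g : Fin k → Sym k} → (∀ i → last (f i) ≡ just (g i)) →
        ∀ is → map last (map f is) ≡ map just (map g is)
      lasts-map last≡ []       = refl
      lasts-map last≡ (i ∷ is) = cong₂ _∷_ (last≡ i) (lasts-map last≡ is)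
      b#a-lasts : ∀ is →
        map last (map (λ i → b ∷ hash i ∷ a ∷ []) is) ≡ map just (replicate (length is) a)
      b#a-lasts []       = refl
      b#a-lasts (_ ∷ is) = cong (just a ∷_) (b#a-lasts is)

  uR-isBBWT : IsBBWT (uR k) (expectedBBWT k)
  uR-isBBWT =
    factors , sortedRotations , uR-isLyndonFactorization , sortedRotations-↭ ,
    lexSorted⇒ωSorted factorRotation-prefixFree sortedRotations-factorRotation sortedRotations-sorted ,
    sortedRotations-lasts

  uR-isBBWT-unique : {L : Word k} → IsBBWT (uR k) L → L ≡ expectedBBWT k
  uR-isBBWT-unique {L} (_ , rs , lyndonFactorization , rs↭ , ωSorted , rs-lasts) =
    map-injective just-injective (begin
      map just L                 ≡⟨ rs-lasts ⟨
      map last rs                ≡⟨ cong (map last) rs≡sorted ⟩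
      map last sortedRotations   ≡⟨ sortedRotations-lasts ⟩
      map just (expectedBBWT k)  ∎)
    where
      open ≡-Reasoning
      rs↭sorted : rs ↭ sortedRotations
      rs↭sorted = ↭-trans
        (subst (λ fs → rs ↭ concatMap rotations fs) (uR-lyndonFactorization-unique lyndonFactorization) rs↭)
        (↭-sym sortedRotations-↭)
      rs≡sorted : rs ≡ sortedRotations
      rs≡sorted = ωSorted-unique factorRotation-prefixFree
        (All-resp-↭ (↭-sym rs↭sorted) sortedRotations-factorRotation) rs↭sorted sortedRotations-sorted ωSorted

runs-expectedBBWT : (m : ℕ) → runs (expectedBBWT (suc m)) ≡ 4 * suc m + 1
runs-expectedBBWT m = begin
  runs (bas ++ amps ++ hashes ++ as)
    ≡⟨ runs-++ bas (amps ++ hashes ++ as) (Connected-last bas≢amp₀) ⟩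
  runs bas + runs (amps ++ hashes ++ as)
    ≡⟨ cong (runs bas +_)
            (runs-++ amps (hashes ++ as) (Connected-last (All-map-universal (λ _ ()) (allFin n)))) ⟩
  runs bas + (runs amps + runs (hashes ++ as))
    ≡⟨ cong (λ r → runs bas + (runs amps + r))
            (runs-++ hashes as (Connected-last (All-map-universal (λ _ ()) (allFin n)))) ⟩
  runs bas + (runs amps + (runs hashes + runs as))
    ≡⟨ cong₂ _+_ runs-bas (cong₂ _+_ (runs-distinctLetters amp (λ { i<j refl → <-irrefl refl i<j }))
         (cong₂ _+_ (runs-distinctLetters hash (λ { i<j refl → <-irrefl refl i<j })) (runs-replicate m a))) ⟩
  2 * n + (n + (n + 1))
    ≡⟨ solve 1 (λ n → con 2 :* n :+ (n :+ (n :+ con 1)) := con 4 :* n :+ con 1) refl n ⟩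
  4 * n + 1 ∎
  where
    open ≡-Reasoning
    open +-*-Solver
    n = suc m
    bas amps hashes as : Word n
    bas    = concat (replicate n (b ∷ a ∷ []))
    amps   = map amp (allFin n)
    hashes = map hash (allFin n)
    as     = replicate n a
    bas≢amp₀ : All (_≢ amp zero) bas
    bas≢amp₀ = All.concat⁺ (All.replicate⁺ n ((λ ()) ∷ (λ ()) ∷ []))
    alternating : ∀ j → Linked {A = Sym n} _≢_ (concat (replicate j (b ∷ a ∷ [])))
    alternating zero          = []
    alternating (suc zero)    = (λ ()) ∷ [-]
    alternating (suc (suc j)) = (λ ()) ∷ (λ ()) ∷ alternating (suc j)
    length-alternating : ∀ j → length (concat (replicate {A = Word n} j (b ∷ a ∷ []))) ≡ 2 * j
    length-alternating zero    = refl
    length-alternating (suc j) = trans (cong (2 +_) (length-alternating j)) (sym (*-suc 2 j))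
    runs-bas : runs bas ≡ 2 * n
    runs-bas = trans (runs-distinct (alternating n)) (length-alternating n)
    runs-distinctLetters : (f : Fin n → Sym n) → (∀ {i j} → i <ᶠ j → f i ≢ f j) →
      runs (map f (allFin n)) ≡ n
    runs-distinctLetters f distinct = trans (runs-distinct (Linked-map-allFin f distinct))
      (trans (length-map f (allFin n)) (length-tabulate id))

lemma3p8 : (k : ℕ) → 1 ≤ k →
    (IsBBWT (uR k) (expectedBBWT k) × ((L : List (Sym k)) → IsBBWT (uR k) L → L ≡ expectedBBWT k))
    × runs (expectedBBWT k) ≡ 4 * k + 1
lemma3p8 (suc m) _ = (uR-isBBWT (suc m) , λ _ → uR-isBBWT-unique (suc m)) , runs-expectedBBWT m
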